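{- The map $F$ on partial functions from terms to sets of terms is monotone with respect to inclusion: if $I\subseteq J$ then $F(I)\subseteq F(J)$.
   Context: Terms of $\lambda\Pi/\mathcal{R}$: $t ::= s \mid x \mid f \mid \Pi x{:}t.t \mid t\,t \mid \lambda x{:}t.t$; $\to=\to_\beta\cup\to_{\mathcal{R}}$ for a set $\mathcal{R}$ of rewrite rules, assumed locally confluent; $\mathrm{SN}$ is the set of terminating terms, and each $T\in\mathrm{SN}$ has a unique normal form $T{\downarrow}$. A partial function $I$ from terms to sets of terms is identified with its graph, and $I\subseteq J$ is inclusion of graphs. For sets $P$ and $Q(a)$, $\Pi a\in P.Q(a)=\{t\mid\forall a\in P,\ t\,a\in Q(a)\}$. $D(I)$ is the set of $T\in\mathrm{SN}$ such that whenever $T\to^*\Pi x{:}A.B$ (not necessarily in normal form), $A\in\mathrm{dom}(I)$ and $B[x\mapsto a]\in\mathrm{dom}(I)$ for all $a\in I(A)$. $F(I)$ is the partial function with domain $D(I)$ such that $F(I)(T)=\Pi a\in I(A).\,I(B[x\mapsto a])$ if $T{\downarrow}=\Pi x{:}A.B$, and $F(I)(T)=\mathrm{SN}$ if $T{\downarrow}$ is not a product. -}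

module Defs where

open import Data.Nat using (ℕ; zero; suc)
open import Data.Product using (Σ; ∃; _×_; _,_)
open import Relation.Nullary using (¬_)
open import Relation.Binary.Construct.Closure.ReflexiveTransitive using (Star)

data Sort : Set where
  TYPE KIND : Sort

data Term (Sym : Set) : Set where
  srt : Sort → Term Sym
  var : ℕ → Term Sym
  sym : Sym → Term Sym
  Π   : Term Sym → Term Sym → Term Sym   -- Π x:A.B, B binds index 0
  _·_ : Term Sym → Term Sym → Term Sym
  lam : Term Sym → Term Sym → Term Sym   -- λ x:A.t, t binds index 0

module _ {Sym : Set} where

  ext : (ℕ → ℕ) → ℕ → ℕ
  ext ρ zero    = zero
  ext ρ (suc n) = suc (ρ n)

  rename : (ℕ → ℕ) → Term Sym → Term Sym
  rename ρ (srt s)   = srt s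
  rename ρ (var n)   = var (ρ n)
  rename ρ (sym f)   = sym f
  rename ρ (Π A B)   = Π (rename ρ A) (rename (ext ρ) B)
  rename ρ (t · u)   = rename ρ t · rename ρ u
  rename ρ (lam A t) = lam (rename ρ A) (rename (ext ρ) t)

  exts : (ℕ → Term Sym) → ℕ → Term Sym
  exts σ zero    = var zero
  exts σ (suc n) = rename suc (σ n)

  subst : (ℕ → Term Sym) → Term Sym → Term Sym
  subst σ (srt s)   = srt s
  subst σ (var n)   = σ n
  subst σ (sym f)   = sym f
  subst σ (Π A B)   = Π (subst σ A) (subst (exts σ) B)
  subst σ (t · u)   = subst σ t · subst σ u
  subst σ (lam A t) = lam (subst σ A) (subst (exts σ) t)

  single : Term Sym → ℕ → Term Sym
  single a zero    = a
  single a (suc n) = var n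

  _[_] : Term Sym → Term Sym → Term Sym
  B [ a ] = subst (single a) B

record Rule (Sym : Set) : Set where
  constructor _⇒_
  field
    lhs rhs : Term Sym
open Rule public

module _ {Sym : Set} (R : Rule Sym → Set) where

  data _⟶_ : Term Sym → Term Sym → Set where
    β     : ∀ A t u → (lam A t · u) ⟶ (t [ u ])
    rule  : ∀ ρ → R ρ → (σ : ℕ → Term Sym) → subst σ (lhs ρ) ⟶ subst σ (rhs ρ)
    Π₁    : ∀ {A A'} B → A ⟶ A' → Π A B ⟶ Π A' B
    Π₂    : ∀ A {B B'} → B ⟶ B' → Π A B ⟶ Π A B'
    app₁  : ∀ {t t'} u → t ⟶ t' → (t · u) ⟶ (t' · u)
    app₂  : ∀ t {u u'} → u ⟶ u' → (t · u) ⟶ (t · u')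
    lam₁  : ∀ {A A'} t → A ⟶ A' → lam A t ⟶ lam A' t
    lam₂  : ∀ A {t t'} → t ⟶ t' → lam A t ⟶ lam A t'

  _⟶*_ : Term Sym → Term Sym → Set
  _⟶*_ = Star _⟶_

  LocallyConfluent : Set
  LocallyConfluent = ∀ {t u v} → t ⟶ u → t ⟶ v → ∃ λ w → (u ⟶* w) × (v ⟶* w)

  data SN (t : Term Sym) : Set where
    sn : (∀ {u} → t ⟶ u → SN u) → SN t

  Normal : Term Sym → Set
  Normal t = ∀ {u} → ¬ (t ⟶ u)

TermSet : Set → Set₁
TermSet Sym = Term Sym → Set

_≐_ : {Sym : Set} → TermSet Sym → TermSet Sym → Set
P ≐ Q = ∀ t → (P t → Q t) × (Q t → P t)

-- A partial function: a domain and, for each T in the domain, a value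
-- that does not depend on the membership proof (so its graph
-- {(T, I(T)) | T ∈ dom I} is functional).
record PFun (Sym : Set) : Set₁ where
  field
    dom    : Term Sym → Set
    app    : (T : Term Sym) → dom T → TermSet Sym
    app-irr : ∀ T (d d' : dom T) → app T d ≐ app T d'
open PFun public

-- inclusion of graphs:  every pair (T, I(T)) is a pair (T, J(T))
_⊆_ : {Sym : Set} → PFun Sym → PFun Sym → Set
I ⊆ J = ∀ T (d : dom I T) → Σ (dom J T) λ e → app J T e ≐ app I T d

module _ {Sym : Set} (R : Rule Sym → Set) (I : PFun Sym) where

  D : Term Sym → Set
  D T = SN R T × (∀ {A B} → _⟶*_ R T (Π A B) →
          Σ (dom I A) λ dA → ∀ a → app I A dA a → dom I (B [ a ]))

  -- Π a ∈ I(A). I(B[a])  (quantifying over domain proofs, which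
  -- is harmless by app-irr)
  ΠI : Term Sym → Term Sym → TermSet Sym
  ΠI A B t = ∀ a (dA : dom I A) → app I A dA a →
               (dB : dom I (B [ a ])) → app I (B [ a ]) dB (t · a)

  -- value of F(I) at T, by cases on the normal form T↓ of T
  -- (T↓ is the unique normal N with T →* N)
  NfVal : Term Sym → TermSet Sym
  NfVal (Π A B) = ΠI A B
  NfVal (srt s)   = SN R
  NfVal (var n)   = SN R
  NfVal (sym f)   = SN R
  NfVal (t · u)   = SN R
  NfVal (lam A t) = SN R

  FVal : Term Sym → TermSet Sym
  FVal T t = ∀ N → _⟶*_ R T N → Normal R N → NfVal N t

  F : PFun Sym
  F = record
    { dom = D
    ; app = λ T _ → FVal T
    ; app-irr = λ T d d' t → (λ x → x) , (λ x → x)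
    }

module Submission where

open import Defs
open import Data.Product using (Σ; _,_; proj₁; proj₂)

-- Enlarging I can only add Π-types to the domain and never changes a value
-- I(A) already defined, so D(I) ⊆ D(J) and the value sets F(I)(T), F(J)(T)
-- agree.  The only non-trivial inclusion is Π a ∈ I(A). I(B[a]) ⊆
-- Π a ∈ J(A). J(B[a]): an a ∈ J(A) lies in I(A), and B[a] ∈ dom(I) because
-- T ∈ D(I) and T →* Π A B.

≐-trans : {Sym : Set} {P Q S : TermSet Sym} → P ≐ Q → Q ≐ S → P ≐ S
≐-trans P≐Q Q≐S t =
  (λ p → proj₁ (Q≐S t) (proj₁ (P≐Q t) p)) ,
  (λ s → proj₂ (P≐Q t) (proj₂ (Q≐S t) s))

module ⊆-Properties {Sym : Set} (I J : PFun Sym) (I⊆J : I ⊆ J) where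

  ⊆-app : ∀ T (d : dom I T) (e : dom J T) → app J T e ≐ app I T d
  ⊆-app T d e = ≐-trans (app-irr J T e (proj₁ (I⊆J T d))) (proj₂ (I⊆J T d))

  ⊆-dom : ∀ T → dom I T → dom J T
  ⊆-dom T d = proj₁ (I⊆J T d)

  ⊆-∈ : ∀ T (d : dom I T) (e : dom J T) {a} → app I T d a → app J T e a
  ⊆-∈ T d e {a} = proj₂ (⊆-app T d e a)

  ⊇-∈ : ∀ T (d : dom I T) (e : dom J T) {a} → app J T e a → app I T d a
  ⊇-∈ T d e {a} = proj₁ (⊆-app T d e a)

ΠDom : {Sym : Set} → PFun Sym → Term Sym → Term Sym → Set
ΠDom I A B = Σ (dom I A) λ dA → ∀ a → app I A dA a → dom I (B [ a ])

module _ {Sym : Set} (R : Rule Sym → Set) (I J : PFun Sym) (I⊆J : I ⊆ J) where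

  open ⊆-Properties I J I⊆J

  ΠDom-mono : ∀ A B → ΠDom I A B → ΠDom J A B
  ΠDom-mono A B (dA , dB) = eA , λ a a∈JA → ⊆-dom (B [ a ]) (dB a (⊇-∈ A dA eA a∈JA))
    where
      eA = ⊆-dom A dA

  D-mono : ∀ {T} → D R I T → D R J T
  D-mono (T-sn , ΠT) = T-sn , λ {A} {B} T⟶*Π → ΠDom-mono A B (ΠT T⟶*Π)

  ΠI-antitone : ∀ A B {t} → ΠI R J A B t → ΠI R I A B t
  ΠI-antitone A B t∈ΠJ a dA a∈IA dB =
    ⊇-∈ (B [ a ]) dB eB (t∈ΠJ a eA (⊆-∈ A dA eA a∈IA) eB)
    where
      eA = ⊆-dom A dA
      eB = ⊆-dom (B [ a ]) dB

  ΠI-mono : ∀ A B {t} → ΠDom I A B → ΠI R I A B t → ΠI R J A B t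
  ΠI-mono A B (dA , dB) t∈ΠI a eA a∈JA eB =
    ⊆-∈ (B [ a ]) (dB a a∈IA) eB (t∈ΠI a dA a∈IA (dB a a∈IA))
    where
      a∈IA = ⊇-∈ A dA eA a∈JA

  NfVal-antitone : ∀ N {t} → NfVal R J N t → NfVal R I N t
  NfVal-antitone (srt s)   t∈ = t∈
  NfVal-antitone (var n)   t∈ = t∈
  NfVal-antitone (sym f)   t∈ = t∈
  NfVal-antitone (Π A B)   t∈ = ΠI-antitone A B t∈
  NfVal-antitone (u · v)   t∈ = t∈
  NfVal-antitone (lam A u) t∈ = t∈

  NfVal-mono : ∀ {T} → D R I T → ∀ N → _⟶*_ R T N → ∀ {t} → NfVal R I N t → NfVal R J N t
  NfVal-mono T∈D (srt s)   T⟶*N t∈ = t∈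
  NfVal-mono T∈D (var n)   T⟶*N t∈ = t∈
  NfVal-mono T∈D (sym f)   T⟶*N t∈ = t∈
  NfVal-mono T∈D (Π A B)   T⟶*N t∈ = ΠI-mono A B (proj₂ T∈D T⟶*N) t∈
  NfVal-mono T∈D (u · v)   T⟶*N t∈ = t∈
  NfVal-mono T∈D (lam A u) T⟶*N t∈ = t∈

  FVal-≐ : ∀ {T} → D R I T → FVal R J T ≐ FVal R I T
  FVal-≐ T∈D t =
    (λ t∈FJ N T⟶*N nf → NfVal-antitone N (t∈FJ N T⟶*N nf)) ,
    (λ t∈FI N T⟶*N nf → NfVal-mono T∈D N T⟶*N (t∈FI N T⟶*N nf))

lemma20 : {Sym : Set} (R : Rule Sym → Set) → LocallyConfluent R →
    (I J : PFun Sym) → I ⊆ J → F R I ⊆ F R J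
lemma20 R _ I J I⊆J T T∈D = D-mono R I J I⊆J T∈D , FVal-≐ R I J I⊆J T∈D
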